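{- Let $(c_1',\dots,c_k')$ be a tuple satisfying $\mathcal R$ that minimizes $\sum_{i=1}^k\Phi(c_i',X_i')$ among tuples satisfying $\mathcal R$, and let $C''=(c_1'',\dots,c_k'')$ be any tuple satisfying $\mathcal R$ with \[ \sum_{i=1}^k\Phi(c_i'',X_i')\le\Big(1+\frac{\varepsilon}{16}\Big)\sum_{i=1}^k\Phi(c_i',X_i'). \] Then $\Phi(C'',X)\le(1+\varepsilon)\cdot OPT$.
   Context: $\mathcal H$ is Hamming distance on $\{0,1\}^d$. Let $X\subseteq\{0,1\}^d$ be a set of $n$ points, $k\ge1$, $\mathcal R=\{R_1,\dots,R_d\}$ with $R_i\subseteq\{0,1\}^k$; a tuple $(c_1,\dots,c_k)$ of points of $\{0,1\}^d$ satisfies $\mathcal R$ if $(c_1[i],\dots,c_k[i])\in R_i$ for every coordinate $i$. For a center set $C$ and multiset $Y$, $\Phi(C,Y)=\sum_{y\in Y}\min_{c\in C}\mathcal H(y,c)$ (counting multiplicity), and $\Phi(c,Y)=\Phi(\{c\},Y)$. $OPT$ is the minimum of $\Phi(C,X)$ over tuples $C$ satisfying $\mathcal R$; $OPT^\star$ is the minimum of $\Phi(C,X)$ over sets $C$ of $k$ points of $\{0,1\}^d$. Fix $0<\varepsilon\le\frac12$ and let $B$ be a set of $k$ points of $\{0,1\}^d$ with $\Phi(B,X)\le\alpha\cdot OPT^\star$. For $x\in X$ let $n(x)$ be a point of $B$ nearest to $x$. Let $(c_1,\dots,c_k)$ satisfy $\mathcal R$ with $\Phi(\{c_1,\dots,c_k\},X)=OPT$,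 let $X_j$ be the set of $x\in X$ whose nearest center among $c_1,\dots,c_k$ is $c_j$ (ties broken arbitrarily, so the $X_j$ partition $X$). Let $I_s=\{j:\Phi(B,X_j)\le\frac{\varepsilon}{6\alpha k}\Phi(B,X)\}$ and $I_l=\{j:\Phi(B,X_j)>\frac{\varepsilon}{6\alpha k}\Phi(B,X)\}$. For $j\in I_l$: $R_j=\frac\varepsilon9\cdot\frac{\Phi(B,X_j)}{|X_j|}$, $X_j^{near}=\{x\in X_j:\min_{b\in B}\mathcal H(x,b)\le R_j\}$, $X_j^{far}=X_j\setminus X_j^{near}$. Define multisets $X_j'=\{n(x):x\in X_j\}$ for $j\in I_s$, and $X_j'=X_j^{far}\cup\{n(x):x\in X_j^{near}\}$ for $j\in I_l$ (one copy of $n(x)$ per $x$).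
   Formalization: The parameters ε and α are rational numbers. -}

module Defs where

open import Data.Bool using (Bool; true; false; if_then_else_; _xor_)
open import Data.Nat as ℕ using (ℕ; zero; suc; _⊓_)
open import Data.Fin as Fin using (Fin)
open import Data.Vec using (Vec; lookup; tabulate)
open import Data.List using (List; []; _∷_; map; allFin; concatMap)
open import Data.Nat.ListAction using (sum)
open import Data.Integer using (+_)
open import Data.Rational as ℚ using (ℚ)
import Data.Rational.Properties as ℚP
open import Relation.Nullary.Decidable using (⌊_⌋)

Point : ℕ → Set
Point d = Vec Bool d

H : ∀ {d} → Point d → Point d → ℕ
H {d} x y = sum (map (λ i → if lookup x i xor lookup y i then 1 else 0) (allFin d))

-- minimum of finitely many naturals (junk value 0 for the empty family;
-- only used with k ≥ 1)
minOver : ∀ {k} → (Fin k → ℕ) → ℕ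
minOver {zero} f = 0
minOver {suc zero} f = f Fin.zero
minOver {suc (suc k)} f = f Fin.zero ⊓ minOver (λ j → f (Fin.suc j))

dist : ∀ {d k} → (Fin k → Point d) → Point d → ℕ
dist C y = minOver (λ j → H y (C j))

Φ : ∀ {d k} → (Fin k → Point d) → List (Point d) → ℕ
Φ C Y = sum (map (dist C) Y)

Φ₁ : ∀ {d} → Point d → List (Point d) → ℕ
Φ₁ c Y = sum (map (λ y → H y c) Y)

Σ[_] : (k : ℕ) → (Fin k → ℕ) → ℕ
Σ[ k ] f = sum (map f (allFin k))

-- tuple (c_1,…,c_k) satisfies R = (R_1,…,R_d), R_i ⊆ {0,1}^k
Satisfies : ∀ {d k} → (Fin d → Vec Bool k → Set) → (Fin k → Point d) → Set
Satisfies {d} {k} R c = (i : Fin d) → R i (tabulate (λ j → lookup (c j) i))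

⟦_⟧ : ℕ → ℚ
⟦ n ⟧ = (+ n) ℚ./ 1

toL : ∀ {d n} → (Fin n → Point d) → List (Point d)
toL {n = n} X = map X (allFin n)

-- cluster X_j of the optimal solution, given the assignment a : X → {1..k}
cluster : ∀ {d n k} → (Fin n → Point d) → (Fin n → Fin k) → Fin k → List (Point d)
cluster {n = n} X a j =
  concatMap (λ i → if ⌊ a i Fin.≟ j ⌋ then X i ∷ [] else []) (allFin n)

-- j ∈ I_s  ⇔  Φ(B,X_j) ≤ ε/(6αk) Φ(B,X)   (denominators cleared; α>0, k≥1)
isSmall : ∀ {d n k} → ℚ → ℚ → (Fin n → Point d) → (Fin k → Point d)
          → (Fin n → Fin k) → Fin k → Bool
isSmall {k = k} ε α X B a j =
  ⌊ (⟦ 6 ⟧ ℚ.* α ℚ.* ⟦ k ⟧ ℚ.* ⟦ Φ B (cluster X a j) ⟧)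
      ℚP.≤? (ε ℚ.* ⟦ Φ B (toL X) ⟧) ⌋

-- x_i ∈ X_j^near  ⇔  min_b H(x_i,b) ≤ R_j = (ε/9)·Φ(B,X_j)/|X_j|
-- (denominator |X_j| cleared; here min_b H(x_i,b) = H(x_i, B (nB i)))
isNear : ∀ {d n k} → ℚ → (Fin n → Point d) → (Fin k → Point d)
         → (Fin n → Fin k) → (Fin n → Fin k) → Fin k → Fin n → Bool
isNear ε X B nB a j i =
  ⌊ (⟦ 9 ⟧ ℚ.* ⟦ Data.List.length (cluster X a j) ⟧ ℚ.* ⟦ H (X i) (B (nB i)) ⟧)
      ℚP.≤? (ε ℚ.* ⟦ Φ B (cluster X a j) ⟧) ⌋

rep : ∀ {d n k} → ℚ → ℚ → (Fin n → Point d) → (Fin k → Point d)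
      → (Fin n → Fin k) → (Fin n → Fin k) → Fin k → Fin n → Point d
rep ε α X B nB a j i =
  if isSmall ε α X B a j then B (nB i)
  else (if isNear ε X B nB a j i then B (nB i) else X i)

X′ : ∀ {d n k} → ℚ → ℚ → (Fin n → Point d) → (Fin k → Point d)
     → (Fin n → Fin k) → (Fin n → Fin k) → Fin k → List (Point d)
X′ {n = n} ε α X B nB a j =
  concatMap (λ i → if ⌊ a i Fin.≟ j ⌋ then rep ε α X B nB a j i ∷ [] else [])
            (allFin n)

-- Replacing each point x_i by its representative in X′ moves it by δ_i, and the total
-- movement D is at most (5/12)·ε·Φ(c,X).  In a small cluster every point moves at most
-- its distance to B, and the whole cluster is cheap by the definition of I_s and the
-- α-approximation of B.  In a large cluster only near points move, by at most R_j, and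
-- routing all of X_j through c_j and x_i to the point of B nearest x_i gives
-- R_j ≤ (ε/9)(Q_j/|X_j| + γ_i + β_i), where Q_j = Φ(c_j,X_j) and γ_i, β_i are the
-- distances from x_i to c_j and to B; absorbing β_i (ε ≤ 1/2) and summing over the
-- cluster bounds its movement by ε·Q_j/4.  By the triangle inequality the cost of any
-- centres on the multisets X′_j differs from Φ(·,X) by at most D, hence
-- Φ(C″,X) ≤ (1+ε/16)(Φ(c,X) + D) + D ≤ (1+ε)·Φ(c,X).

module Submission where

open import Defs
open import Data.Bool using (Bool)
open import Data.Nat as ℕ using (ℕ)
open import Data.Fin using (Fin)
open import Data.Vec using (Vec)
open import Data.Integer using (+_)
open import Data.Rational as ℚ using (ℚ)
open import Relation.Binary.PropositionalEquality using (_≡_)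

open import Data.Bool using (T; true; false; if_then_else_; _xor_)
open import Data.Bool.Properties using (xor-comm; xor-same)
import Data.Fin as Fin
import Data.Integer as ℤ
import Data.Integer.Properties as ℤ
open import Data.List as List using (List; []; _∷_; _++_; map; tabulate; length)
import Data.List.Properties as List
import Data.Nat.ListAction as ListAction
import Data.Nat.ListAction.Properties as ListAction
import Data.Nat.Coprimality as Coprime
open import Data.Nat using (zero; suc; _+_; _*_; _≤_; z≤n; NonZero; >-nonZero)
open import Data.Nat.Properties
open import Algebra.Properties.CommutativeMonoid.Sum +-0-commutativeMonoid
  using (sum; sum-syntax; sum-cong-≗; sum-replicate-zero; ∑-distrib-+; ∑-comm)
open import Algebra.Properties.Semiring.Sum +-*-semiring using (*-distribˡ-sum)
open import Data.Nat.Tactic.RingSolver using (solve)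
open import Data.Product using (∃₂; _,_)
import Data.Rational.Properties as ℚ
open import Data.Rational.Unnormalised as ℚᵘ using (mkℚᵘ)
import Data.Rational.Unnormalised.Properties as ℚᵘ
open import Data.Sum using (_⊎_; inj₁; inj₂)
open import Data.Unit using (tt)
open import Data.Vec using (lookup)
open import Function using (_∘_)
open import Relation.Binary.PropositionalEquality using (refl; sym; trans; cong; cong₂; subst; subst₂; module ≡-Reasoning)
open import Relation.Nullary using (yes; no)
open import Relation.Nullary.Decidable using (⌊_⌋; isYes≗does; toWitness)

∑-mono-≤ : ∀ {n} {f g : Fin n → ℕ} → (∀ i → f i ≤ g i) → sum f ≤ sum g
∑-mono-≤ {zero}  f≤g = z≤n
∑-mono-≤ {suc n} f≤g = +-mono-≤ (f≤g Fin.zero) (∑-mono-≤ (f≤g ∘ Fin.suc))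

∑-const : ∀ n c → ∑[ i < n ] c ≡ n * c
∑-const zero    c = refl
∑-const (suc n) c = cong (_+_ c) (∑-const n c)

-- Not definitional: ⌊_⌋ matches on the whole Dec record, which _≟_ rebuilds with map′.
⌊suc≟suc⌋ : ∀ {k} (x y : Fin k) → ⌊ Fin.suc x Fin.≟ Fin.suc y ⌋ ≡ ⌊ x Fin.≟ y ⌋
⌊suc≟suc⌋ x y = trans (isYes≗does (Fin.suc x Fin.≟ Fin.suc y)) (sym (isYes≗does (x Fin.≟ y)))

∑-δ : ∀ {k} (x : Fin k) (g : Fin k → ℕ) → ∑[ j < k ] (if ⌊ x Fin.≟ j ⌋ then g j else 0) ≡ g x
∑-δ {suc k} Fin.zero    g = trans (cong (_+_ (g Fin.zero)) (sum-replicate-zero k)) (+-identityʳ _)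
∑-δ {suc k} (Fin.suc x) g =
  trans (sum-cong-≗ (λ j → cong (λ b → if b then g (Fin.suc j) else 0) (⌊suc≟suc⌋ x j)))
        (∑-δ x (g ∘ Fin.suc))

∑-fibres : ∀ {k n} (a : Fin n → Fin k) (F : Fin k → Fin n → ℕ) →
           ∑[ j < k ] ∑[ i < n ] (if ⌊ a i Fin.≟ j ⌋ then F j i else 0) ≡ ∑[ i < n ] F (a i) i
∑-fibres {k} {n} a F = trans (∑-comm {k} {n} (λ j i → if ⌊ a i Fin.≟ j ⌋ then F j i else 0))
                             (sum-cong-≗ (λ i → ∑-δ (a i) (λ j → F j i)))

if-+ : ∀ b x y → (if b then x + y else 0) ≡ (if b then x else 0) + (if b then y else 0)
if-+ true  x y = refl
if-+ false x y = refl

if-* : ∀ b c x → (if b then c * x else 0) ≡ c * (if b then x else 0)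
if-* true  c x = refl
if-* false c x = sym (*-zeroʳ c)

∑-if-empty : ∀ {n} (b : Fin n → Bool) (f : Fin n → ℕ) →
             ∑[ i < n ] (if b i then 1 else 0) ≡ 0 → ∑[ i < n ] (if b i then f i else 0) ≡ 0
∑-if-empty {zero}  b f _ = refl
∑-if-empty {suc n} b f empty with b Fin.zero
... | false = ∑-if-empty (b ∘ Fin.suc) (f ∘ Fin.suc) empty

sum-map-tabulate : ∀ {A : Set} {n} (f : A → ℕ) (g : Fin n → A) →
                   ListAction.sum (map f (tabulate g)) ≡ ∑[ i < n ] f (g i)
sum-map-tabulate {n = zero}  f g = refl
sum-map-tabulate {n = suc n} f g = cong (_+_ (f (g Fin.zero))) (sum-map-tabulate f (g ∘ Fin.suc))

sum-map-concatMap-if : ∀ {A B : Set} (h : B → ℕ) (b : A → Bool) (y : A → B) {n} (g : Fin n → A) →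
  ListAction.sum (map h (List.concatMap (λ x → if b x then y x ∷ [] else []) (tabulate g)))
  ≡ ∑[ i < n ] (if b (g i) then h (y (g i)) else 0)
sum-map-concatMap-if h b y {zero}  g = refl
sum-map-concatMap-if {A} {B} h b y {suc n} g = begin
  ListAction.sum (map h (item (g Fin.zero) ++ rest))                         ≡⟨ cong ListAction.sum (List.map-++ h (item (g Fin.zero)) rest) ⟩
  ListAction.sum (map h (item (g Fin.zero)) ++ map h rest)                  ≡⟨ ListAction.sum-++ (map h (item (g Fin.zero))) _ ⟩
  ListAction.sum (map h (item (g Fin.zero))) + ListAction.sum (map h rest)  ≡⟨ cong₂ _+_ (sum-item (b (g Fin.zero)))
                                                                                     (sum-map-concatMap-if h b y (g ∘ Fin.suc)) ⟩
  ∑[ i < suc n ] (if b (g i) then h (y (g i)) else 0)                      ∎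
  where
  open ≡-Reasoning
  item : A → List B
  item x = if b x then y x ∷ [] else []
  rest : List B
  rest = List.concatMap item (tabulate (g ∘ Fin.suc))
  sum-item : ∀ t → ListAction.sum (map h (if t then y (g Fin.zero) ∷ [] else [])) ≡ (if t then h (y (g Fin.zero)) else 0)
  sum-item true  = +-identityʳ _
  sum-item false = refl

length≡sum-map-1 : ∀ {A : Set} (xs : List A) → length xs ≡ ListAction.sum (map (λ _ → 1) xs)
length≡sum-map-1 []       = refl
length≡sum-map-1 (x ∷ xs) = cong suc (length≡sum-map-1 xs)

bitDist : Bool → Bool → ℕ
bitDist u v = if u xor v then 1 else 0

H≡∑bitDist : ∀ {d} (x y : Point d) → H x y ≡ ∑[ i < d ] bitDist (lookup x i) (lookup y i)
H≡∑bitDist x y = sum-map-tabulate (λ i → bitDist (lookup x i) (lookup y i)) (λ i → i)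

bitDist-triangle : ∀ u v w → bitDist u w ≤ bitDist u v + bitDist v w
bitDist-triangle false false false = z≤n
bitDist-triangle false false true  = ≤-refl
bitDist-triangle false true  false = z≤n
bitDist-triangle false true  true  = ≤-refl
bitDist-triangle true  false false = ≤-refl
bitDist-triangle true  false true  = z≤n
bitDist-triangle true  true  false = ≤-refl
bitDist-triangle true  true  true  = z≤n

H-triangle : ∀ {d} (x y z : Point d) → H x z ≤ H x y + H y z
H-triangle {d} x y z = begin
  H x z                                   ≡⟨ H≡∑bitDist x z ⟩
  ∑[ i < d ] bitDist (x ! i) (z ! i)      ≤⟨ ∑-mono-≤ (λ i → bitDist-triangle (x ! i) (y ! i) (z ! i)) ⟩
  ∑[ i < d ] (bitDist (x ! i) (y ! i) + bitDist (y ! i) (z ! i))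
                                          ≡⟨ ∑-distrib-+ (λ i → bitDist (x ! i) (y ! i)) (λ i → bitDist (y ! i) (z ! i)) ⟩
  ∑[ i < d ] bitDist (x ! i) (y ! i) + ∑[ i < d ] bitDist (y ! i) (z ! i)
                                          ≡⟨ cong₂ _+_ (H≡∑bitDist x y) (H≡∑bitDist y z) ⟨
  H x y + H y z                           ∎
  where
  open ≤-Reasoning
  _!_ : Point d → Fin d → Bool
  _!_ = lookup

H-sym : ∀ {d} (x y : Point d) → H x y ≡ H y x
H-sym x y = trans (H≡∑bitDist x y)
  (trans (sum-cong-≗ (λ i → cong (λ b → if b then 1 else 0) (xor-comm (lookup x i) (lookup y i))))
         (sym (H≡∑bitDist y x)))

H-self : ∀ {d} (x : Point d) → H x x ≡ 0
H-self {d} x = trans (H≡∑bitDist x x)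
  (trans (sum-cong-≗ (λ i → cong (λ b → if b then 1 else 0) (xor-same (lookup x i))))
         (sum-replicate-zero d))

∑-H-triangle : ∀ {d n} (x y z : Fin n → Point d) →
               ∑[ i < n ] H (x i) (z i) ≤ ∑[ i < n ] H (x i) (y i) + ∑[ i < n ] H (y i) (z i)
∑-H-triangle x y z = ≤-trans (∑-mono-≤ (λ i → H-triangle (x i) (y i) (z i)))
                             (≤-reflexive (∑-distrib-+ (λ i → H (x i) (y i)) (λ i → H (y i) (z i))))

minOver-≤ : ∀ {k} (f : Fin k → ℕ) j → minOver f ≤ f j
minOver-≤ {suc zero}    f Fin.zero    = ≤-refl
minOver-≤ {suc (suc k)} f Fin.zero    = m⊓n≤m _ _
minOver-≤ {suc (suc k)} f (Fin.suc j) = ≤-trans (m⊓n≤n _ _) (minOver-≤ (f ∘ Fin.suc) j)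

minOver-greatest : ∀ {k m} (f : Fin k → ℕ) → Fin k → (∀ j → m ≤ f j) → m ≤ minOver f
minOver-greatest {suc zero}    f _ m≤f = m≤f Fin.zero
minOver-greatest {suc (suc k)} f _ m≤f =
  ⊓-glb (m≤f Fin.zero) (minOver-greatest (f ∘ Fin.suc) Fin.zero (m≤f ∘ Fin.suc))

dist-nearest : ∀ {d k} (C : Fin k → Point d) y j₀ → (∀ j → H y (C j₀) ≤ H y (C j)) → dist C y ≡ H y (C j₀)
dist-nearest C y j₀ nearest = ≤-antisym (minOver-≤ _ j₀) (minOver-greatest _ j₀ nearest)

Φ-toL : ∀ {d k n} (C : Fin k → Point d) (X : Fin n → Point d) → Φ C (toL X) ≡ ∑[ i < n ] dist C (X i)
Φ-toL C X = trans (cong (ListAction.sum ∘ map (dist C)) (List.map-tabulate (λ i → i) X))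
                  (sum-map-tabulate (dist C) X)

-- The denominator is an index, so that cross-multiplying ratios yields plain ℕ expressions.
data Ratio (r : ℚ) (a : ℕ) : ℕ → Set where
  ratio : ∀ {b} → ℚ.toℚᵘ r ℚᵘ.≃ mkℚᵘ (+ a) b → Ratio r a (suc b)

ratio-⟦⟧ : ∀ n → Ratio ⟦ n ⟧ n 1
ratio-⟦⟧ n = ratio (ℚᵘ.≃-reflexive (cong ℚ.toℚᵘ (ℚ.normalize-coprime (Coprime.sym (Coprime.1-coprimeTo n)))))

ratio-1 : Ratio ℚ.1ℚ 1 1
ratio-1 = ratio ℚᵘ.≃-refl

ratio-½ : Ratio ℚ.½ 1 2
ratio-½ = ratio ℚᵘ.≃-refl

ratio-1/16 : Ratio (+ 1 ℚ./ 16) 1 16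
ratio-1/16 = ratio ℚᵘ.≃-refl

ratio-* : ∀ {r s a b c d} → Ratio r a b → Ratio s c d → Ratio (r ℚ.* s) (a * c) (b * d)
ratio-* {r} {s} {a} {c = c} (ratio r≃) (ratio s≃) = ratio
  (ℚᵘ.≃-trans (ℚ.toℚᵘ-homo-* r s)
    (ℚᵘ.≃-trans (ℚᵘ.*-cong r≃ s≃) (ℚᵘ.≃-reflexive (cong (λ z → mkℚᵘ z _) (sym (ℤ.pos-* a c))))))

ratio-+ : ∀ {r s a b c d} → Ratio r a b → Ratio s c d → Ratio (r ℚ.+ s) (a * d + c * b) (b * d)
ratio-+ {r} {s} {a} {suc b} {c} {suc d} (ratio r≃) (ratio s≃) = ratio
  (ℚᵘ.≃-trans (ℚ.toℚᵘ-homo-+ r s)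
    (ℚᵘ.≃-trans (ℚᵘ.+-cong r≃ s≃) (ℚᵘ.≃-reflexive (cong (λ z → mkℚᵘ z _)
      (sym (trans (ℤ.pos-+ (a * suc d) (c * suc b)) (cong₂ ℤ._+_ (ℤ.pos-* a (suc d)) (ℤ.pos-* c (suc b)))))))))

ratio-≤ : ∀ {r s a b c d} → Ratio r a b → Ratio s c d → r ℚ.≤ s → a * d ≤ c * b
ratio-≤ {a = a} {b} {c} {d} (ratio r≃) (ratio s≃) r≤s
  with ℚᵘ.≤-respˡ-≃ r≃ (ℚᵘ.≤-respʳ-≃ s≃ (ℚ.toℚᵘ-mono-≤ r≤s))
... | ℚᵘ.*≤* ad≤cb = ℤ.drop‿+≤+ (subst₂ ℤ._≤_ (sym (ℤ.pos-* a d)) (sym (ℤ.pos-* c b)) ad≤cb)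

≤-ratio : ∀ {r s a b c d} → Ratio r a b → Ratio s c d → a * d ≤ c * b → r ℚ.≤ s
≤-ratio {a = a} {b} {c} {d} (ratio r≃) (ratio s≃) ad≤cb =
  ℚ.toℚᵘ-cancel-≤ (ℚᵘ.≤-respˡ-≃ (ℚᵘ.≃-sym r≃) (ℚᵘ.≤-respʳ-≃ (ℚᵘ.≃-sym s≃)
    (ℚᵘ.*≤* (subst₂ ℤ._≤_ (ℤ.pos-* a d) (ℤ.pos-* c b) (ℤ.+≤+ ad≤cb)))))

positive-ratio : ∀ r → ℚ.0ℚ ℚ.< r → ∃₂ λ a b → Ratio r (suc a) b
positive-ratio (ℚ.mkℚ (+ suc a) b _)   _                  = a , suc b , ratio ℚᵘ.≃-refl
positive-ratio (ℚ.mkℚ (+ zero) b _)    (ℚ.*<* (ℤ.+<+ ()))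
positive-ratio (ℚ.mkℚ ℤ.-[1+ m ] b _) (ℚ.*<* ())

≤-resp-≡ : ∀ {m m′ n n′ : ℕ} → m ≤ n → m ≡ m′ → n ≡ n′ → m′ ≤ n′
≤-resp-≡ m≤n refl refl = m≤n

⟦⟧≤*⟦⟧⇒ : ∀ {r u v} x y → Ratio r u v → ⟦ x ⟧ ℚ.≤ r ℚ.* ⟦ y ⟧ → x * v ≤ u * y
⟦⟧≤*⟦⟧⇒ {u = u} {v} x y r≐ h =
  ≤-resp-≡ (ratio-≤ (ratio-⟦⟧ x) (ratio-* r≐ (ratio-⟦⟧ y)) h) (solve (x ∷ v ∷ [])) (solve (u ∷ y ∷ []))

≤½⇒ : ∀ {r p q} → Ratio r p q → r ℚ.≤ ℚ.½ → 2 * p ≤ q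
≤½⇒ {p = p} {q} r≐ h = ≤-resp-≡ (ratio-≤ r≐ ratio-½ h) (solve (p ∷ [])) (solve (q ∷ []))

small-test⇒ : ∀ {ε α p q u v} k x y → Ratio ε p q → Ratio α u v →
              ⟦ 6 ⟧ ℚ.* α ℚ.* ⟦ k ⟧ ℚ.* ⟦ x ⟧ ℚ.≤ ε ℚ.* ⟦ y ⟧ → 6 * u * k * x * q ≤ p * y * v
small-test⇒ {p = p} {q} {u} {v} k x y ε≐ α≐ h = ≤-resp-≡
  (ratio-≤ (ratio-* (ratio-* (ratio-* (ratio-⟦⟧ 6) α≐) (ratio-⟦⟧ k)) (ratio-⟦⟧ x)) (ratio-* ε≐ (ratio-⟦⟧ y)) h)
  (solve (u ∷ k ∷ x ∷ q ∷ [])) (solve (p ∷ y ∷ v ∷ []))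

near-test⇒ : ∀ {ε p q} m x y → Ratio ε p q → ⟦ 9 ⟧ ℚ.* ⟦ m ⟧ ℚ.* ⟦ x ⟧ ℚ.≤ ε ℚ.* ⟦ y ⟧ → 9 * m * x * q ≤ p * y
near-test⇒ {p = p} {q} m x y ε≐ h = ≤-resp-≡
  (ratio-≤ (ratio-* (ratio-* (ratio-⟦⟧ 9) (ratio-⟦⟧ m)) (ratio-⟦⟧ x)) (ratio-* ε≐ (ratio-⟦⟧ y)) h)
  (solve (m ∷ x ∷ q ∷ [])) (solve (p ∷ y ∷ []))

≤1+ε/16⇒ : ∀ {ε p q} x y → Ratio ε p q → ⟦ x ⟧ ℚ.≤ (ℚ.1ℚ ℚ.+ ε ℚ.* (+ 1 ℚ./ 16)) ℚ.* ⟦ y ⟧ →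
           16 * q * x ≤ (16 * q + p) * y
≤1+ε/16⇒ {p = p} {q} x y ε≐ h = ≤-resp-≡
  (ratio-≤ (ratio-⟦⟧ x) (ratio-* (ratio-+ ratio-1 (ratio-* ε≐ ratio-1/16)) (ratio-⟦⟧ y)) h)
  (solve (q ∷ x ∷ [])) (solve (p ∷ q ∷ y ∷ []))

⇒≤1+ε : ∀ {ε p q} x y → Ratio ε p q → q * x ≤ (q + p) * y → ⟦ x ⟧ ℚ.≤ (ℚ.1ℚ ℚ.+ ε) ℚ.* ⟦ y ⟧
⇒≤1+ε {p = p} {q} x y ε≐ h = ≤-ratio (ratio-⟦⟧ x) (ratio-* (ratio-+ ratio-1 ε≐) (ratio-⟦⟧ y))
  (≤-resp-≡ h (solve (q ∷ x ∷ [])) (solve (p ∷ q ∷ y ∷ [])))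

*-cancelˡ-≤-unless-0 : ∀ m {x y} → m * x ≤ m * y → (m ≡ 0 → x ≡ 0) → x ≤ y
*-cancelˡ-≤-unless-0 zero    _     x≡0 = subst (_≤ _) (sym (x≡0 refl)) z≤n
*-cancelˡ-≤-unless-0 (suc m) mx≤my _   = *-cancelˡ-≤ (suc m) mx≤my

-- ε ≤ 1/2 lets the β on the right be absorbed: 9 − ε ≥ 8.
near-point-arith : ∀ p q m β γ P Q → 9 * m * β * q ≤ p * P → P ≤ Q + (γ + β) * m → 2 * p ≤ q →
                   8 * m * q * β ≤ p * (Q + m * γ)
near-point-arith p q m β γ P Q near P≤ 2p≤q =
  *-cancelˡ-≤ 2 (+-cancelʳ-≤ (m * q * β) (2 * (8 * m * q * β)) (2 * (p * (Q + m * γ))) (begin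
    2 * (8 * m * q * β) + m * q * β               ≤⟨ m≤m+n _ (m * q * β) ⟩
    2 * (8 * m * q * β) + m * q * β + m * q * β   ≡⟨ solve (m ∷ q ∷ β ∷ []) ⟩
    2 * (9 * m * β * q)                           ≤⟨ *-monoʳ-≤ 2 near ⟩
    2 * (p * P)                                   ≤⟨ *-monoʳ-≤ 2 (*-monoʳ-≤ p P≤) ⟩
    2 * (p * (Q + (γ + β) * m))                   ≡⟨ solve (p ∷ Q ∷ m ∷ γ ∷ β ∷ []) ⟩
    2 * (p * (Q + m * γ)) + 2 * p * (m * β)       ≤⟨ +-monoʳ-≤ (2 * (p * (Q + m * γ))) (*-monoˡ-≤ (m * β) 2p≤q) ⟩
    2 * (p * (Q + m * γ)) + q * (m * β)           ≡⟨ cong (_+_ (2 * (p * (Q + m * γ)))) (solve (q ∷ m ∷ β ∷ [])) ⟩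
    2 * (p * (Q + m * γ)) + m * q * β             ∎))
  where open ≤-Reasoning

small-cluster-arith : ∀ p q u v k P PB OPT E → 6 * suc u * k * P * q ≤ p * PB * v → PB * v ≤ suc u * OPT →
                      E ≤ P → 6 * k * q * E ≤ p * OPT
small-cluster-arith p q u v k P PB OPT E small α-approx E≤P = *-cancelˡ-≤ (suc u) (begin
  suc u * (6 * k * q * E)   ≡⟨ solve (u ∷ k ∷ q ∷ E ∷ []) ⟩
  suc u * 6 * k * q * E     ≤⟨ *-monoʳ-≤ (suc u * 6 * k * q) E≤P ⟩
  suc u * 6 * k * q * P     ≡⟨ solve (u ∷ k ∷ q ∷ P ∷ []) ⟩
  6 * suc u * k * P * q     ≤⟨ small ⟩
  p * PB * v                ≡⟨ *-assoc p PB v ⟩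
  p * (PB * v)              ≤⟨ *-monoʳ-≤ p α-approx ⟩
  p * (suc u * OPT)         ≡⟨ solve (p ∷ u ∷ OPT ∷ []) ⟩
  suc u * (p * OPT)         ∎)
  where open ≤-Reasoning

large-cluster-arith : ∀ p q m E Q → 8 * m * q * E ≤ p * (Q * m + m * Q) → (m ≡ 0 → E ≡ 0) → 4 * q * E ≤ p * Q
large-cluster-arith p q m E Q h empty = *-cancelˡ-≤ 2 (≤-resp-≡ 8qE≤2pQ (solve (q ∷ E ∷ [])) refl)
  where
  8qE≤2pQ : 8 * q * E ≤ 2 * (p * Q)
  8qE≤2pQ = *-cancelˡ-≤-unless-0 m (≤-resp-≡ h (solve (m ∷ q ∷ E ∷ [])) (solve (p ∷ Q ∷ m ∷ [])))
              (λ m≡0 → trans (cong (8 * q *_) (empty m≡0)) (*-zeroʳ (8 * q)))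

cluster-arith : ∀ p q k E OPT Q → 6 * k * q * E ≤ p * OPT ⊎ 4 * q * E ≤ p * Q →
                12 * k * q * E ≤ p * (2 * OPT + 3 * k * Q)
cluster-arith p q k E OPT Q (inj₁ small) = begin
  12 * k * q * E            ≡⟨ solve (k ∷ q ∷ E ∷ []) ⟩
  2 * (6 * k * q * E)       ≤⟨ *-monoʳ-≤ 2 small ⟩
  2 * (p * OPT)             ≡⟨ solve (p ∷ OPT ∷ []) ⟩
  p * (2 * OPT)             ≤⟨ *-monoʳ-≤ p (m≤m+n (2 * OPT) (3 * k * Q)) ⟩
  p * (2 * OPT + 3 * k * Q) ∎
  where open ≤-Reasoning
cluster-arith p q k E OPT Q (inj₂ large) = begin
  12 * k * q * E            ≡⟨ solve (k ∷ q ∷ E ∷ []) ⟩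
  3 * k * (4 * q * E)       ≤⟨ *-monoʳ-≤ (3 * k) large ⟩
  3 * k * (p * Q)           ≡⟨ solve (k ∷ p ∷ Q ∷ []) ⟩
  p * (3 * k * Q)           ≤⟨ *-monoʳ-≤ p (m≤n+m (3 * k * Q) (2 * OPT)) ⟩
  p * (2 * OPT + 3 * k * Q) ∎
  where open ≤-Reasoning

movement-arith : ∀ p q k D OPT .{{_ : NonZero k}} → 12 * k * q * D ≤ p * (k * (2 * OPT) + 3 * k * OPT) →
                 12 * q * D ≤ 5 * p * OPT
movement-arith p q k D OPT h = *-cancelˡ-≤ k (≤-resp-≡ h (solve (k ∷ q ∷ D ∷ [])) (solve (p ∷ k ∷ OPT ∷ [])))

-- (1 + ε/16)(1 + 5ε/12) + 5ε/12 ≤ 1 + ε for ε ≤ 1/2, scaled by 384 = 16 · 24.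
final-arith : ∀ p q Φ″ S″ S′ OPT D → Φ″ ≤ S″ + D → 16 * q * S″ ≤ (16 * q + p) * S′ → S′ ≤ OPT + D →
              12 * q * D ≤ 5 * p * OPT → 2 * p ≤ q → q * Φ″ ≤ (q + p) * OPT
final-arith p q Φ″ S″ S′ OPT D Φ″≤ S″≤ S′≤ D≤ 2p≤q = *-cancelˡ-≤ 384 (begin
  384 * (q * Φ″)                                        ≤⟨ *-monoʳ-≤ 384 (*-monoʳ-≤ q Φ″≤) ⟩
  384 * (q * (S″ + D))                                  ≡⟨ solve (q ∷ S″ ∷ D ∷ []) ⟩
  24 * (16 * q * S″) + 384 * q * D                      ≤⟨ +-monoˡ-≤ (384 * q * D) (*-monoʳ-≤ 24 S″≤) ⟩
  24 * ((16 * q + p) * S′) + 384 * q * D                ≤⟨ +-monoˡ-≤ (384 * q * D) (*-monoʳ-≤ 24 (*-monoʳ-≤ (16 * q + p) S′≤)) ⟩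
  24 * ((16 * q + p) * (OPT + D)) + 384 * q * D         ≡⟨ solve (p ∷ q ∷ OPT ∷ D ∷ []) ⟩
  24 * (16 * q + p) * OPT + 768 * q * D + 12 * (2 * p) * D
                                                        ≤⟨ +-monoʳ-≤ (24 * (16 * q + p) * OPT + 768 * q * D) (*-monoˡ-≤ D (*-monoʳ-≤ 12 2p≤q)) ⟩
  24 * (16 * q + p) * OPT + 768 * q * D + 12 * q * D    ≡⟨ solve (p ∷ q ∷ OPT ∷ D ∷ []) ⟩
  24 * (16 * q + p) * OPT + 65 * (12 * q * D)           ≤⟨ +-monoʳ-≤ (24 * (16 * q + p) * OPT) (*-monoʳ-≤ 65 D≤) ⟩
  24 * (16 * q + p) * OPT + 65 * (5 * p * OPT)          ≡⟨ solve (p ∷ q ∷ OPT ∷ []) ⟩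
  384 * (q * OPT) + 349 * (p * OPT)                     ≤⟨ +-monoʳ-≤ (384 * (q * OPT)) (*-monoˡ-≤ (p * OPT) (m≤m+n 349 35)) ⟩
  384 * (q * OPT) + 384 * (p * OPT)                     ≡⟨ solve (p ∷ q ∷ OPT ∷ []) ⟩
  384 * ((q + p) * OPT)                                 ∎)
  where open ≤-Reasoning

module Clusters {k n : ℕ} (a : Fin n → Fin k) where

  restrict : Fin k → (Fin n → ℕ) → Fin n → ℕ
  restrict j f i = if ⌊ a i Fin.≟ j ⌋ then f i else 0

  ∑ᶜ : Fin k → (Fin n → ℕ) → ℕ
  ∑ᶜ j f = sum (restrict j f)

  size : Fin k → ℕ
  size j = ∑ᶜ j (λ _ → 1)

  ∑ᶜ-mono-≤ : ∀ j {f g : Fin n → ℕ} → (∀ i → a i ≡ j → f i ≤ g i) → ∑ᶜ j f ≤ ∑ᶜ j g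
  ∑ᶜ-mono-≤ j {f} {g} f≤g = ∑-mono-≤ restrict-≤
    where
    restrict-≤ : ∀ i → restrict j f i ≤ restrict j g i
    restrict-≤ i with a i Fin.≟ j
    ... | yes ai≡j = f≤g i ai≡j
    ... | no _     = z≤n

  ∑ᶜ-distrib-+ : ∀ j (f g : Fin n → ℕ) → ∑ᶜ j (λ i → f i + g i) ≡ ∑ᶜ j f + ∑ᶜ j g
  ∑ᶜ-distrib-+ j f g = trans (sum-cong-≗ (λ i → if-+ ⌊ a i Fin.≟ j ⌋ (f i) (g i)))
                             (∑-distrib-+ (restrict j f) (restrict j g))

  ∑ᶜ-*ˡ : ∀ j c (f : Fin n → ℕ) → ∑ᶜ j (λ i → c * f i) ≡ c * ∑ᶜ j f
  ∑ᶜ-*ˡ j c f = trans (sum-cong-≗ (λ i → if-* ⌊ a i Fin.≟ j ⌋ c (f i))) (sym (*-distribˡ-sum c (restrict j f)))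

  ∑ᶜ-const : ∀ j c → ∑ᶜ j (λ _ → c) ≡ c * size j
  ∑ᶜ-const j c = trans (sum-cong-≗ (λ i → cong (λ x → if ⌊ a i Fin.≟ j ⌋ then x else 0) (sym (*-identityʳ c))))
                       (∑ᶜ-*ˡ j c (λ _ → 1))

  ∑ᶜ-empty : ∀ j (f : Fin n → ℕ) → size j ≡ 0 → ∑ᶜ j f ≡ 0
  ∑ᶜ-empty j = ∑-if-empty (λ i → ⌊ a i Fin.≟ j ⌋)

  ∑-∑ᶜ : (F : Fin k → Fin n → ℕ) → ∑[ j < k ] ∑ᶜ j (F j) ≡ ∑[ i < n ] F (a i) i
  ∑-∑ᶜ = ∑-fibres a

module Analysis {d k n : ℕ} (X : Fin n → Point d) (ε α : ℚ)
  (B : Fin k → Point d) (nB : Fin n → Fin k) (B-nearest : ∀ i j → H (X i) (B (nB i)) ≤ H (X i) (B j))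
  (c : Fin k → Point d) (a : Fin n → Fin k) (c-nearest : ∀ i j → H (X i) (c (a i)) ≤ H (X i) (c j)) where

  open Clusters a

  r : Fin k → Fin n → Point d
  r = rep ε α X B nB a

  γ β : Fin n → ℕ
  γ i = H (X i) (c (a i))
  β i = H (X i) (B (nB i))

  movement : ℕ
  movement = ∑[ i < n ] H (X i) (r (a i) i)

  cost : (Fin k → Point d) → ℕ
  cost C = Σ[ k ] (λ j → Φ₁ (C j) (X′ ε α X B nB a j))

  E Q : Fin k → ℕ
  E j = ∑ᶜ j (λ i → H (X i) (r j i))
  Q j = ∑ᶜ j γ

  Φc≡∑γ : Φ c (toL X) ≡ ∑[ i < n ] γ i
  Φc≡∑γ = trans (Φ-toL c X) (sum-cong-≗ (λ i → dist-nearest c (X i) (a i) (c-nearest i)))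

  Φ-B-cluster : ∀ j → Φ B (cluster X a j) ≡ ∑ᶜ j β
  Φ-B-cluster j = trans (sum-map-concatMap-if (dist B) (λ i → ⌊ a i Fin.≟ j ⌋) X (λ i → i))
    (sum-cong-≗ (λ i → cong (λ x → if ⌊ a i Fin.≟ j ⌋ then x else 0) (dist-nearest B (X i) (nB i) (B-nearest i))))

  length-cluster : ∀ j → length (cluster X a j) ≡ size j
  length-cluster j = trans (length≡sum-map-1 (cluster X a j)) (sum-map-concatMap-if (λ _ → 1) (λ i → ⌊ a i Fin.≟ j ⌋) X (λ i → i))

  cost≡ : ∀ C → cost C ≡ ∑[ i < n ] H (r (a i) i) (C (a i))
  cost≡ C = trans (sum-map-tabulate (λ j → Φ₁ (C j) (X′ ε α X B nB a j)) (λ j → j))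
    (trans (sum-cong-≗ (λ j → sum-map-concatMap-if (λ y → H y (C j)) (λ i → ⌊ a i Fin.≟ j ⌋) (r j) (λ i → i)))
           (∑-∑ᶜ (λ j i → H (r j i) (C j))))

  Φ-≤-cost+movement : ∀ C → Φ C (toL X) ≤ cost C + movement
  Φ-≤-cost+movement C = begin
    Φ C (toL X)                             ≡⟨ Φ-toL C X ⟩
    ∑[ i < n ] dist C (X i)                 ≤⟨ ∑-mono-≤ (λ i → minOver-≤ (λ j → H (X i) (C j)) (a i)) ⟩
    ∑[ i < n ] H (X i) (C (a i))            ≤⟨ ∑-H-triangle X (λ i → r (a i) i) (λ i → C (a i)) ⟩
    movement + ∑[ i < n ] H (r (a i) i) (C (a i)) ≡⟨ +-comm movement _ ⟩
    ∑[ i < n ] H (r (a i) i) (C (a i)) + movement ≡⟨ cong (_+ movement) (cost≡ C) ⟨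
    cost C + movement                       ∎
    where open ≤-Reasoning

  cost-≤-Φ+movement : cost c ≤ Φ c (toL X) + movement
  cost-≤-Φ+movement = begin
    cost c                                  ≡⟨ cost≡ c ⟩
    ∑[ i < n ] H (r (a i) i) (c (a i))      ≤⟨ ∑-H-triangle (λ i → r (a i) i) X (λ i → c (a i)) ⟩
    ∑[ i < n ] H (r (a i) i) (X i) + ∑[ i < n ] γ i
                                            ≡⟨ cong₂ _+_ (sum-cong-≗ (λ i → H-sym (r (a i) i) (X i))) (sym Φc≡∑γ) ⟩
    movement + Φ c (toL X)                  ≡⟨ +-comm movement _ ⟩
    Φ c (toL X) + movement                  ∎
    where open ≤-Reasoning

  Φ-B-cluster-≤ : ∀ i j → a i ≡ j → Φ B (cluster X a j) ≤ Q j + (γ i + β i) * size j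
  Φ-B-cluster-≤ i j ai≡j = begin
    Φ B (cluster X a j)                     ≡⟨ Φ-B-cluster j ⟩
    ∑ᶜ j β                                  ≤⟨ ∑ᶜ-mono-≤ j via-c-j ⟩
    ∑ᶜ j (λ i′ → γ i′ + (γ i + β i))        ≡⟨ ∑ᶜ-distrib-+ j γ (λ _ → γ i + β i) ⟩
    Q j + ∑ᶜ j (λ _ → γ i + β i)            ≡⟨ cong (_+_ (Q j)) (∑ᶜ-const j (γ i + β i)) ⟩
    Q j + (γ i + β i) * size j              ∎
    where
    open ≤-Reasoning
    via-c-j : ∀ i′ → a i′ ≡ j → β i′ ≤ γ i′ + (γ i + β i)
    via-c-j i′ refl = begin
      β i′                                  ≤⟨ B-nearest i′ (nB i) ⟩
      H (X i′) (B (nB i))                   ≤⟨ H-triangle (X i′) (c (a i′)) (B (nB i)) ⟩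
      γ i′ + H (c (a i′)) (B (nB i))        ≤⟨ +-monoʳ-≤ (γ i′) (H-triangle (c (a i′)) (X i) (B (nB i))) ⟩
      γ i′ + (H (c (a i′)) (X i) + β i)     ≡⟨ cong (λ h → γ i′ + (h + β i)) (trans (H-sym (c (a i′)) (X i)) (cong (λ j → H (X i) (c j)) (sym ai≡j))) ⟩
      γ i′ + (γ i + β i)                    ∎

  rep-small : ∀ j i → isSmall ε α X B a j ≡ true → r j i ≡ B (nB i)
  rep-small j i small = cong (λ s → if s then B (nB i) else (if isNear ε X B nB a j i then B (nB i) else X i)) small

  rep-large : ∀ j i → isSmall ε α X B a j ≡ false → ∀ {t} → isNear ε X B nB a j i ≡ t →
              r j i ≡ (if t then B (nB i) else X i)
  rep-large j i large near = trans
    (cong (λ s → if s then B (nB i) else (if isNear ε X B nB a j i then B (nB i) else X i)) large)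
    (cong (λ t → if t then B (nB i) else X i) near)

  module Bounds {p q u v : ℕ} (ε≐ : Ratio ε p q) (α≐ : Ratio α (suc u) v) (2p≤q : 2 * p ≤ q)
                (B-approx : Φ B (toL X) * v ≤ suc u * Φ c (toL X)) where

    small-cluster : ∀ j → isSmall ε α X B a j ≡ true → 6 * k * q * E j ≤ p * Φ c (toL X)
    small-cluster j small = small-cluster-arith p q u v k (Φ B (cluster X a j)) _ _ (E j)
      (small-test⇒ k (Φ B (cluster X a j)) (Φ B (toL X)) ε≐ α≐ (toWitness (subst T (sym small) tt)))
      B-approx
      (≤-trans (∑ᶜ-mono-≤ j (λ i _ → ≤-reflexive (cong (H (X i)) (rep-small j i small))))
               (≤-reflexive (sym (Φ-B-cluster j))))

    large-cluster : ∀ j → isSmall ε α X B a j ≡ false → 4 * q * E j ≤ p * Q j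
    large-cluster j large = large-cluster-arith p q (size j) (E j) (Q j) summed (∑ᶜ-empty j _)
      where
      m : ℕ
      m = size j
      per-point : ∀ i → a i ≡ j → 8 * m * q * H (X i) (r j i) ≤ p * (Q j + m * γ i)
      per-point i ai≡j = by-nearness (isNear ε X B nB a j i) refl
        where
        by-nearness : ∀ t → isNear ε X B nB a j i ≡ t → 8 * m * q * H (X i) (r j i) ≤ p * (Q j + m * γ i)
        by-nearness true near = subst (λ h → 8 * m * q * h ≤ p * (Q j + m * γ i)) (sym (cong (H (X i)) (rep-large j i large near)))
          (near-point-arith p q m (β i) (γ i) (Φ B (cluster X a j)) (Q j)
            (subst (λ m → 9 * m * β i * q ≤ p * Φ B (cluster X a j)) (length-cluster j)
              (near-test⇒ (length (cluster X a j)) (β i) (Φ B (cluster X a j)) ε≐ (toWitness (subst T (sym near) tt))))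
            (Φ-B-cluster-≤ i j ai≡j) 2p≤q)
        by-nearness false far = subst (_≤ p * (Q j + m * γ i))
          (sym (trans (cong (λ h → 8 * m * q * H (X i) h) (rep-large j i large far))
                      (trans (cong (8 * m * q *_) (H-self (X i))) (*-zeroʳ (8 * m * q))))) z≤n
      summed : 8 * m * q * E j ≤ p * (Q j * m + m * Q j)
      summed = begin
        8 * m * q * E j                                ≡⟨ ∑ᶜ-*ˡ j (8 * m * q) (λ i → H (X i) (r j i)) ⟨
        ∑ᶜ j (λ i → 8 * m * q * H (X i) (r j i))       ≤⟨ ∑ᶜ-mono-≤ j per-point ⟩
        ∑ᶜ j (λ i → p * (Q j + m * γ i))               ≡⟨ ∑ᶜ-*ˡ j p (λ i → Q j + m * γ i) ⟩
        p * ∑ᶜ j (λ i → Q j + m * γ i)                 ≡⟨ cong (p *_) (∑ᶜ-distrib-+ j (λ _ → Q j) (λ i → m * γ i)) ⟩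
        p * (∑ᶜ j (λ _ → Q j) + ∑ᶜ j (λ i → m * γ i))  ≡⟨ cong (p *_) (cong₂ _+_ (∑ᶜ-const j (Q j)) (∑ᶜ-*ˡ j m γ)) ⟩
        p * (Q j * m + m * Q j)                        ∎
        where open ≤-Reasoning

    cluster-bound : ∀ j → 12 * k * q * E j ≤ p * (2 * Φ c (toL X) + 3 * k * Q j)
    cluster-bound j = cluster-arith p q k (E j) (Φ c (toL X)) (Q j) (by-size (isSmall ε α X B a j) refl)
      where
      by-size : ∀ s → isSmall ε α X B a j ≡ s → 6 * k * q * E j ≤ p * Φ c (toL X) ⊎ 4 * q * E j ≤ p * Q j
      by-size true  small = inj₁ (small-cluster j small)
      by-size false large = inj₂ (large-cluster j large)

    movement-bound : .{{_ : NonZero k}} → 12 * q * movement ≤ 5 * p * Φ c (toL X)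
    movement-bound = movement-arith p q k movement OPT (begin
      12 * k * q * movement                           ≡⟨ cong (12 * k * q *_) (∑-∑ᶜ (λ j i → H (X i) (r j i))) ⟨
      12 * k * q * ∑[ j < k ] E j                     ≡⟨ *-distribˡ-sum (12 * k * q) E ⟩
      ∑[ j < k ] (12 * k * q * E j)                   ≤⟨ ∑-mono-≤ cluster-bound ⟩
      ∑[ j < k ] (p * (2 * OPT + 3 * k * Q j))         ≡⟨ *-distribˡ-sum p (λ j → 2 * OPT + 3 * k * Q j) ⟨
      p * ∑[ j < k ] (2 * OPT + 3 * k * Q j)           ≡⟨ cong (p *_) (∑-distrib-+ (λ _ → 2 * OPT) (λ j → 3 * k * Q j)) ⟩
      p * (∑[ j < k ] (2 * OPT) + ∑[ j < k ] (3 * k * Q j))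
                                                      ≡⟨ cong (p *_) (cong₂ _+_ (∑-const k (2 * OPT)) 3k∑Q≡3kOPT) ⟩
      p * (k * (2 * OPT) + 3 * k * OPT)                ∎)
      where
      open ≤-Reasoning
      OPT : ℕ
      OPT = Φ c (toL X)
      3k∑Q≡3kOPT : ∑[ j < k ] (3 * k * Q j) ≡ 3 * k * OPT
      3k∑Q≡3kOPT = trans (sym (*-distribˡ-sum (3 * k) Q)) (cong (3 * k *_) (trans (∑-∑ᶜ (λ _ → γ)) (sym Φc≡∑γ)))

lemma5 : (d k n : ℕ) → 1 ℕ.≤ k
    → (X : Fin n → Point d) → (∀ i i′ → X i ≡ X i′ → i ≡ i′)
    → (R : Fin d → Vec Bool k → Set)
    → (ε α : ℚ) → ℚ.0ℚ ℚ.< ε → ε ℚ.≤ ℚ.½ → ℚ.0ℚ ℚ.< α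
    → (B : Fin k → Point d)
    → ((C : Fin k → Point d) → ⟦ Φ B (toL X) ⟧ ℚ.≤ α ℚ.* ⟦ Φ C (toL X) ⟧)
    → (nB : Fin n → Fin k)
    → ((i : Fin n) (j : Fin k) → H (X i) (B (nB i)) ℕ.≤ H (X i) (B j))
    → (c : Fin k → Point d) → Satisfies R c
    → ((C : Fin k → Point d) → Satisfies R C → Φ c (toL X) ℕ.≤ Φ C (toL X))
    → (a : Fin n → Fin k)
    → ((i : Fin n) (j : Fin k) → H (X i) (c (a i)) ℕ.≤ H (X i) (c j))
    → (c′ : Fin k → Point d) → Satisfies R c′
    → ((C : Fin k → Point d) → Satisfies R C
         → Σ[ k ] (λ j → Φ₁ (c′ j) (X′ ε α X B nB a j))
           ℕ.≤ Σ[ k ] (λ j → Φ₁ (C j) (X′ ε α X B nB a j)))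
    → (c″ : Fin k → Point d) → Satisfies R c″
    → ⟦ Σ[ k ] (λ j → Φ₁ (c″ j) (X′ ε α X B nB a j)) ⟧
        ℚ.≤ (ℚ.1ℚ ℚ.+ ε ℚ.* (+ 1 ℚ./ 16))
            ℚ.* ⟦ Σ[ k ] (λ j → Φ₁ (c′ j) (X′ ε α X B nB a j)) ⟧
    → ⟦ Φ c″ (toL X) ⟧ ℚ.≤ (ℚ.1ℚ ℚ.+ ε) ℚ.* ⟦ Φ c (toL X) ⟧
lemma5 d k n 1≤k X _ _ ε α ε>0 ε≤½ α>0 B B-approx nB B-nearest c c-sat _ a c-nearest
       c′ _ c′-optimal c″ _ c″-approx
  = conclude (positive-ratio ε ε>0) (positive-ratio α α>0)
  where
  open Analysis X ε α B nB B-nearest c a c-nearest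
  conclude : (∃₂ λ p₀ q → Ratio ε (suc p₀) q) → (∃₂ λ u v → Ratio α (suc u) v) →
             ⟦ Φ c″ (toL X) ⟧ ℚ.≤ (ℚ.1ℚ ℚ.+ ε) ℚ.* ⟦ Φ c (toL X) ⟧
  conclude (p₀ , q , ε≐) (u , v , α≐) = ⇒≤1+ε (Φ c″ (toL X)) (Φ c (toL X)) ε≐
    (final-arith (suc p₀) q (Φ c″ (toL X)) (cost c″) (cost c′) (Φ c (toL X)) movement
      (Φ-≤-cost+movement c″)
      (≤1+ε/16⇒ (cost c″) (cost c′) ε≐ c″-approx)
      (≤-trans (c′-optimal c c-sat) cost-≤-Φ+movement)
      (movement-bound {{>-nonZero 1≤k}})
      2p≤q)
    where
    2p≤q : 2 * suc p₀ ≤ q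
    2p≤q = ≤½⇒ ε≐ ε≤½
    open Bounds ε≐ α≐ 2p≤q (⟦⟧≤*⟦⟧⇒ (Φ B (toL X)) (Φ c (toL X)) α≐ (B-approx c))
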